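{- Lossless graph summarization is in P. More precisely, let $G=(V,E)$ be a finite simple undirected graph, and consider the following algorithm. Initially all nodes are unmarked. For each node $u\in V$ (in any order) that is still unmarked: create the supernode $S(u)=\{u\}$, mark $u$, and then for each unmarked $v\in V$, if $N(u)=N(v)$ or $N(u)\setminus\{v\}=N(v)\setminus\{u\}$, add $v$ to $S(u)$ and mark $v$; record $S(u)$ as a supernode. Finally, for every pair of recorded supernodes $S,S'$ (possibly $S=S'$), add the superedge $\{S,S'\}$ if and only if there exist $u\in S$, $v\in S'$ with $\{u,v\}\in E$. Then this algorithm runs in time polynomial in the size of $G$, and its output is a lossless summary of $G$ whose number of supernodes is minimum among all lossless summaries of $G$.
   Context: $N(u)$ denotes the set of neighbours of $u$ in $G$. A summary of $G$ is a pair $(\mathcal{V},\mathcal{E})$ where $\mathcal{V}$ is a partition of $V$ into nonempty sets (supernodes) and $\mathcal{E}$ a set of unordered pairs $\{S_i,S_j\}$ of supernodes ($i=j$ allowed, a self-loop), called superedges. Its reconstruction is the simple graph on $V$ containing, for each superedge $\{S_i,S_j\}$ with $i\neq j$, all pairs $\{u,w\}$ with $u\in S_i, w\in S_j$, and for each self-loop $\{S_i,S_i\}$, all pairs of distinct nodes of $S_i$. The summary is lossless if its reconstruction equals $G$. The lossless graph summarization problem asks, given $G$, for a lossless summary minimizing the number $|\mathcal{V}|$ of supernodes. -}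

module Defs where

open import Data.Nat using (ℕ; zero; suc; _+_)
open import Data.Bool using (Bool; true; false; not; _∧_; _∨_; _xor_; if_then_else_)
open import Data.Fin using (Fin; _≟_)
open import Data.List using (List; []; _∷_; allFin; length; lookup)
open import Data.Bool.ListAction using (any)
open import Data.List.Membership.Propositional using (_∈_)
open import Data.Product using (Σ; ∃; _×_; _,_; proj₁; proj₂)
open import Relation.Nullary using (¬_)
open import Relation.Nullary.Decidable using (⌊_⌋)
open import Relation.Binary.PropositionalEquality using (_≡_)
open import Function.Bundles using (_⇔_)

record Graph (n : ℕ) : Set where
  field
    adj   : Fin n → Fin n → Bool
    sym   : ∀ u v → adj u v ≡ adj v u
    irref : ∀ u → adj u u ≡ false
open Graph public

-- Summaries.  k supernodes S_0 … S_{k-1}, each given as a list of nodes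
-- (read as a set via membership), and superedges given by a Bool table
-- on pairs of supernode indices (i = j allowed: self-loop).

record Summary (n : ℕ) : Set where
  field
    k      : ℕ
    part   : Fin k → List (Fin n)
    sedge  : Fin k → Fin k → Bool
open Summary public

record IsSummary {n : ℕ} (S : Summary n) : Set where
  field
    nonempty  : ∀ i → ∃ λ u → u ∈ part S i
    covers    : ∀ u → ∃ λ i → u ∈ part S i
    disjoint  : ∀ u i j → u ∈ part S i → u ∈ part S j → i ≡ j
    sedge-sym : ∀ i j → sedge S i j ≡ sedge S j i

RecEdge : ∀ {n} → Summary n → Fin n → Fin n → Set
RecEdge S u w =
  ¬ (u ≡ w) × (∃ λ i → ∃ λ j → u ∈ part S i × w ∈ part S j × sedge S i j ≡ true)

Lossless : ∀ {n} → Graph n → Summary n → Set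
Lossless G S = IsSummary S × (∀ u w → (adj G u w ≡ true) ⇔ RecEdge S u w)

-- Cost model: computations returning (number of elementary steps , value).
-- One step per adjacency query and one step per loop iteration.

C : Set → Set
C A = ℕ × A

ret : ∀ {A} → A → C A
ret a = 0 , a

_>>=_ : ∀ {A B : Set} → C A → (A → C B) → C B
(c , a) >>= f = let (d , b) = f a in (c + d) , b

tick : ∀ {A} → C A → C A
tick (c , a) = suc c , a

query : ∀ {n} → Graph n → Fin n → Fin n → C Bool
query G u v = 1 , adj G u v

allC : ∀ {X : Set} → List X → (X → C Bool) → C Bool
allC []       p = ret true
allC (x ∷ xs) p = tick (p x >>= λ b → allC xs p >>= λ r → ret (b ∧ r))

anyC : ∀ {X : Set} → List X → (X → C Bool) → C Bool
anyC []       p = ret false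
anyC (x ∷ xs) p = tick (p x >>= λ b → anyC xs p >>= λ r → ret (b ∨ r))

filterC : ∀ {X : Set} → (X → C Bool) → List X → C (List X)
filterC p []       = ret []
filterC p (x ∷ xs) = tick (p x >>= λ b → filterC p xs >>= λ r →
                       ret (if b then x ∷ r else r))

forC : ∀ {X : Set} → List X → (X → C Bool) → C Bool
forC = allC

_≟ᵇ_ : ∀ {n} → Fin n → Fin n → Bool
u ≟ᵇ v = ⌊ u ≟ v ⌋

-- Test  N(u) = N(v)  or  N(u) \ {v} = N(v) \ {u}.
mergeTest : ∀ {n} → Graph n → Fin n → Fin n → C Bool
mergeTest {n} G u v =
  allC (allFin n) (λ w → query G u w >>= λ a → query G v w >>= λ b →
                          ret (not (a xor b))) >>= λ same →
  allC (allFin n) (λ w → query G u w >>= λ a → query G v w >>= λ b →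
                          ret (not ((a ∧ not (w ≟ᵇ v)) xor (b ∧ not (w ≟ᵇ u))))) >>= λ same' →
  ret (same ∨ same')

phase1 : ∀ {n} → Graph n → List (Fin n) → (Fin n → Bool) → C (List (List (Fin n)))
phase1 G []       m = ret []
phase1 {n} G (u ∷ us) m with m u
... | true  = tick (phase1 G us m)
... | false =
  tick (filterC (λ v → if m v ∨ (v ≟ᵇ u) then ret false else mergeTest G u v)
                (allFin n) >>= λ rest →
        let S = u ∷ rest in
        phase1 G us (λ v → m v ∨ any (λ s → s ≟ᵇ v) S) >>= λ L →
        ret (S ∷ L))

edgeC : ∀ {n} → Graph n → List (Fin n) → List (Fin n) → C Bool
edgeC G S S' = anyC S (λ u → anyC S' (λ v → query G u v))

mkSummary : ∀ {n} → Graph n → List (List (Fin n)) → Summary n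
mkSummary G L = record
  { k     = length L
  ; part  = lookup L
  ; sedge = λ i j → proj₂ (edgeC G (lookup L i) (lookup L j)) }

algorithm : ∀ {n} → Graph n → List (Fin n) → C (Summary n)
algorithm G ord =
  phase1 G ord (λ _ → false) >>= λ L →
  forC L (λ S → forC L (λ S' → edgeC G S S' >>= λ _ → ret true)) >>= λ _ →
  ret (mkSummary G L)

algCost : ∀ {n} → Graph n → List (Fin n) → ℕ
algCost G ord = proj₁ (algorithm G ord)

algOutput : ∀ {n} → Graph n → List (Fin n) → Summary n
algOutput G ord = proj₂ (algorithm G ord)

-- Call u and v twins when N(u) \ {v} = N(v) \ {u}; this is an equivalence
-- relation, and the merge test of the algorithm decides it.  In a lossless
-- summary any two nodes of one supernode are twins, and conversely, if a is
-- adjacent to b then every twin of a is adjacent to every twin of b distinct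
-- from it.  Phase 1 records exactly the twin classes, so the summary on the
-- twin classes is lossless, and choosing a representative of each class
-- gives an injection into the supernodes of any lossless summary.  Each
-- merge test costs O(n) queries and each superedge test O(n²), so the
-- running time is O(n⁴).
module Submission where

open import Defs renaming (sym to adj-sym)
open import Data.Nat using (ℕ; suc; _+_; _*_; _^_; _≤_; z≤n; s≤s)
open import Data.Nat.Properties
  using (≤-refl; ≤-trans; ≤-reflexive; +-identityʳ; +-mono-≤; +-monoˡ-≤; *-mono-≤; *-monoˡ-≤;
         m≤n+m; m≤m+n; m≤n⇒m≤1+n)
open import Data.Nat.Tactic.RingSolver using (solve-∀)
open import Data.Bool using (Bool; true; false; not; _∧_; _∨_; _xor_; if_then_else_)
open import Data.Bool.Properties
  using (∧-conicalˡ; ∧-conicalʳ; ∨-conicalˡ; ∨-zeroʳ; ∧-zeroʳ; ∧-identityʳ)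
open import Data.Bool.ListAction using (any)
open import Data.Fin using (Fin; _≟_)
open import Data.List using (List; []; _∷_; allFin; length; lookup)
open import Data.List.Properties using (length-tabulate)
open import Data.List.Relation.Unary.All as All using (All; []; _∷_)
open import Data.List.Relation.Unary.Any as Any using (Any; here; there)
open import Data.List.Relation.Unary.Any.Properties using (lookup-index)
open import Data.List.Relation.Unary.AllPairs using (AllPairs; []; _∷_)
open import Data.List.Membership.Propositional using (_∈_; _∉_)
open import Data.List.Membership.Propositional.Properties using (∈-allFin; ∈-lookup)
open import Data.List.Relation.Binary.Permutation.Propositional using (_↭_; ↭-sym)
open import Data.List.Relation.Binary.Permutation.Propositional.Properties
  using (∈-resp-↭; ↭-length)
open import Data.Fin.Properties using (injective⇒≤)
open import Data.Product using (∃; _×_; _,_; proj₁; proj₂)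
open import Data.Empty using (⊥-elim)
open import Relation.Nullary using (¬_; Dec; yes; no)
open import Level using (0ℓ)
open import Relation.Binary.Core using (Rel)
open import Relation.Binary.Definitions using (Symmetric)
open import Relation.Binary.PropositionalEquality
  using (_≡_; _≢_; refl; sym; trans; cong; subst; module ≡-Reasoning)
open import Function.Bundles using (mk⇔; Equivalence)

⇔true⇒≡ : ∀ {a b : Bool} → (a ≡ true → b ≡ true) → (b ≡ true → a ≡ true) → a ≡ b
⇔true⇒≡ {false} {false} _ _ = refl
⇔true⇒≡ {false} {true}  _ g = g refl
⇔true⇒≡ {true}  {false} f _ = sym (f refl)
⇔true⇒≡ {true}  {true}  _ _ = refl

not-xor⇒≡ : ∀ {a b} → not (a xor b) ≡ true → a ≡ b
not-xor⇒≡ {false} {false} _ = refl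
not-xor⇒≡ {true}  {true}  _ = refl

≡⇒not-xor : ∀ {a b} → a ≡ b → not (a xor b) ≡ true
≡⇒not-xor {false} refl = refl
≡⇒not-xor {true}  refl = refl

≟ᵇ-refl : ∀ {n} (u : Fin n) → (u ≟ᵇ u) ≡ true
≟ᵇ-refl u with u ≟ u
... | yes _   = refl
... | no u≢u = ⊥-elim (u≢u refl)

≟ᵇ-≢ : ∀ {n} {u v : Fin n} → u ≢ v → (u ≟ᵇ v) ≡ false
≟ᵇ-≢ {u = u} {v} u≢v with u ≟ v
... | yes u≡v = ⊥-elim (u≢v u≡v)
... | no _    = refl

true≢false : true ≢ false
true≢false ()

∈⇒any-≟ᵇ : ∀ {n} {v : Fin n} (S : List (Fin n)) → v ∈ S → any (λ s → s ≟ᵇ v) S ≡ true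
∈⇒any-≟ᵇ         (s ∷ S) (here refl) rewrite ≟ᵇ-refl s = refl
∈⇒any-≟ᵇ {v = v} (s ∷ S) (there v∈) =
  trans (cong ((s ≟ᵇ v) ∨_) (∈⇒any-≟ᵇ S v∈)) (∨-zeroʳ (s ≟ᵇ v))

∉⇒any-≟ᵇ : ∀ {n} {v : Fin n} (S : List (Fin n)) → v ∉ S → any (λ s → s ≟ᵇ v) S ≡ false
∉⇒any-≟ᵇ         []      _  = refl
∉⇒any-≟ᵇ {v = v} (s ∷ S) v∉ with s ≟ v
... | yes refl = ⊥-elim (v∉ (here refl))
... | no _     = ∉⇒any-≟ᵇ S (λ v∈ → v∉ (there v∈))

∈-drop : ∀ {A : Set} {P : A → Set} {u : A} {us : List A} →
         (∀ w → P w → w ∈ u ∷ us) → ¬ P u → ∀ w → P w → w ∈ us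
∈-drop h ¬Pu w Pw with h w Pw
... | here refl = ⊥-elim (¬Pu Pw)
... | there w∈us = w∈us

AllPairs-lookup : ∀ {A : Set} {R : Rel A 0ℓ} {xs : List A} → Symmetric R → AllPairs R xs →
                  ∀ {i j} → i ≢ j → R (lookup xs i) (lookup xs j)
AllPairs-lookup R-sym (_ ∷ _)  {Fin.zero}  {Fin.zero}  i≢j = ⊥-elim (i≢j refl)
AllPairs-lookup R-sym (px ∷ _) {Fin.zero}  {Fin.suc j} _   = All.lookup px (∈-lookup j)
AllPairs-lookup R-sym (px ∷ _) {Fin.suc i} {Fin.zero}  _   = R-sym (All.lookup px (∈-lookup i))
AllPairs-lookup R-sym (_ ∷ ps) {Fin.suc i} {Fin.suc j} i≢j =
  AllPairs-lookup R-sym ps (λ i≡j → i≢j (cong Fin.suc i≡j))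

+0-≤ : ∀ {m n} → m ≤ n → m + 0 ≤ n
+0-≤ {m} = ≤-trans (≤-reflexive (+-identityʳ m))

length-allFin : ∀ n → length (allFin n) ≡ n
length-allFin n = length-tabulate (λ i → i)

val : ∀ {A} → C A → A
val = proj₂

cost : ∀ {A} → C A → ℕ
cost = proj₁

module _ {X : Set} where

  allC-true⁺ : ∀ (xs : List X) {p : X → C Bool} →
               (∀ {x} → x ∈ xs → val (p x) ≡ true) → val (allC xs p) ≡ true
  allC-true⁺ []       h = refl
  allC-true⁺ (x ∷ xs) h rewrite h (here refl) = allC-true⁺ xs (λ x∈xs → h (there x∈xs))

  allC-true⁻ : ∀ {xs : List X} {p : X → C Bool} →
               val (allC xs p) ≡ true → ∀ {x} → x ∈ xs → val (p x) ≡ true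
  allC-true⁻ {y ∷ _} {p} e (here refl)  = ∧-conicalˡ (val (p y)) _ e
  allC-true⁻ {y ∷ _} {p} e (there x∈xs) = allC-true⁻ (∧-conicalʳ (val (p y)) _ e) x∈xs

  anyC-true⁺ : ∀ (xs : List X) {p : X → C Bool} {x} → x ∈ xs → val (p x) ≡ true →
               val (anyC xs p) ≡ true
  anyC-true⁺ (y ∷ xs) (here refl) e rewrite e = refl
  anyC-true⁺ (y ∷ xs) {p} (there x∈xs) e =
    trans (cong (val (p y) ∨_) (anyC-true⁺ xs x∈xs e)) (∨-zeroʳ (val (p y)))

  anyC-true⁻ : ∀ (xs : List X) {p : X → C Bool} → val (anyC xs p) ≡ true →
               ∃ λ x → x ∈ xs × val (p x) ≡ true
  anyC-true⁻ (y ∷ xs) {p} e with val (p y) in py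
  ... | true  = y , here refl , py
  ... | false with anyC-true⁻ xs e
  ...   | x , x∈xs , px = x , there x∈xs , px

  ∈-filterC⁺ : ∀ (p : X → C Bool) (xs : List X) {x} → x ∈ xs → val (p x) ≡ true →
               x ∈ val (filterC p xs)
  ∈-filterC⁺ p (y ∷ xs) (here refl) e rewrite e = here refl
  ∈-filterC⁺ p (y ∷ xs) (there x∈xs) e with val (p y)
  ... | true  = there (∈-filterC⁺ p xs x∈xs e)
  ... | false = ∈-filterC⁺ p xs x∈xs e

  ∈-filterC⁻ : ∀ (p : X → C Bool) (xs : List X) {x} → x ∈ val (filterC p xs) → val (p x) ≡ true
  ∈-filterC⁻ p (y ∷ xs) x∈ with val (p y) in py
  ∈-filterC⁻ p (y ∷ xs) (here refl) | true = py
  ∈-filterC⁻ p (y ∷ xs) (there x∈) | true = ∈-filterC⁻ p xs x∈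
  ∈-filterC⁻ p (y ∷ xs) x∈          | false = ∈-filterC⁻ p xs x∈

  length-filterC : ∀ (p : X → C Bool) (xs : List X) → length (val (filterC p xs)) ≤ length xs
  length-filterC p []       = z≤n
  length-filterC p (x ∷ xs) with val (p x)
  ... | true  = s≤s (length-filterC p xs)
  ... | false = m≤n⇒m≤1+n (length-filterC p xs)

  allC-cost : ∀ (xs : List X) {p : X → C Bool} {b} →
              (∀ {x} → x ∈ xs → cost (p x) ≤ b) → cost (allC xs p) ≤ length xs * suc b
  allC-cost []       h = z≤n
  allC-cost (x ∷ xs) h = s≤s (+-mono-≤ (h (here refl)) (+0-≤ (allC-cost xs (λ x∈ → h (there x∈)))))

  anyC-cost : ∀ (xs : List X) {p : X → C Bool} {b} →
              (∀ {x} → x ∈ xs → cost (p x) ≤ b) → cost (anyC xs p) ≤ length xs * suc b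
  anyC-cost []       h = z≤n
  anyC-cost (x ∷ xs) h = s≤s (+-mono-≤ (h (here refl)) (+0-≤ (anyC-cost xs (λ x∈ → h (there x∈)))))

  filterC-cost : ∀ (xs : List X) {p : X → C Bool} {b} →
                 (∀ x → cost (p x) ≤ b) → cost (filterC p xs) ≤ length xs * suc b
  filterC-cost []       h = z≤n
  filterC-cost (x ∷ xs) h = s≤s (+-mono-≤ (h x) (+0-≤ (filterC-cost xs h)))

-- The last summand is the slack between the phase bounds and 13 (n+1)⁴.
phaseBounds≤ : ∀ n → n * suc (n * suc (n * 3 + n * 3))
                       + (n * suc (n * suc (suc n * suc (suc n * 2))) + 0)
                     ≤ 13 * suc n ^ 4
phaseBounds≤ n = ≤-trans (m≤m+n _ _) (≤-reflexive (withSlack n))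
  where
  withSlack : ∀ n → n * (1 + n * (1 + (n * 3 + n * 3)))
                    + (n * (1 + n * (1 + (1 + n) * (1 + (1 + n) * 2))) + 0)
                    + (11 * (n * n * n * n) + 41 * (n * n * n) + 73 * (n * n) + 50 * n + 13)
                  ≡ 13 * ((1 + n) * ((1 + n) * ((1 + n) * ((1 + n) * 1))))
  withSlack = solve-∀

module _ {n : ℕ} (G : Graph n) where

  Twins : Fin n → Fin n → Set
  Twins u v = ∀ x → x ≢ u → x ≢ v → adj G u x ≡ adj G v x

  Twins-refl : ∀ {u} → Twins u u
  Twins-refl _ _ _ = refl

  Twins-sym : ∀ {u v} → Twins u v → Twins v u
  Twins-sym uv x x≢v x≢u = sym (uv x x≢u x≢v)

  Twins-trans : ∀ {u v w} → Twins u v → Twins v w → Twins u w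
  Twins-trans {u} {v} {w} uv vw x x≢u x≢w with x ≟ v
  ... | no x≢v = trans (uv x x≢u x≢v) (vw x x≢v x≢w)
  ... | yes refl with u ≟ w
  ...   | yes refl = refl
  ...   | no u≢w = begin
    adj G u x  ≡⟨ adj-sym G u x ⟩
    adj G x u  ≡⟨ vw u (λ u≡x → x≢u (sym u≡x)) u≢w ⟩
    adj G w u  ≡⟨ adj-sym G w u ⟩
    adj G u w  ≡⟨ uv w (λ w≡u → u≢w (sym w≡u)) (λ w≡x → x≢w (sym w≡x)) ⟩
    adj G x w  ≡⟨ adj-sym G x w ⟩
    adj G w x  ∎
    where open ≡-Reasoning

  adj⇒≢ : ∀ {a b} → adj G a b ≡ true → a ≢ b
  adj⇒≢ {a} e refl with trans (sym e) (irref G a)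
  ... | ()

  adj-swap : ∀ {a b} → adj G a b ≡ true → adj G b a ≡ true
  adj-swap {a} {b} = trans (adj-sym G b a)

  adj-transfer : ∀ {a u b} → Twins a u → adj G a b ≡ true → b ≢ u → adj G u b ≡ true
  adj-transfer au ab b≢u = trans (sym (au _ (λ b≡a → adj⇒≢ ab (sym b≡a)) b≢u)) ab

  adj-resp-Twins : ∀ {a u b w} → Twins a u → Twins b w → adj G a b ≡ true → u ≢ w →
                   adj G u w ≡ true
  adj-resp-Twins {a} {u} {b} {w} au bw ab u≢w with b ≟ u
  ... | no b≢u = adj-swap (adj-transfer bw (adj-swap (adj-transfer au ab b≢u)) u≢w)
  ... | yes refl with a ≟ w
  ...   | yes refl = adj-swap ab
  ...   | no a≢w =
    adj-transfer au (adj-swap (adj-transfer bw (adj-swap ab) a≢w)) (λ w≡b → u≢w (sym w≡b))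

  Lossless⇒Twins : ∀ {S : Summary n} → Lossless G S →
                   ∀ {i u v} → u ∈ part S i → v ∈ part S i → Twins u v
  Lossless⇒Twins {S} (isS , rec) {i} u∈ v∈ x x≢u x≢v =
    ⇔true⇒≡ (transport u∈ v∈ x≢v) (transport v∈ u∈ x≢u)
    where
    transport : ∀ {u v} → u ∈ part S i → v ∈ part S i → x ≢ v →
                adj G u x ≡ true → adj G v x ≡ true
    transport {u} {v} u∈ v∈ x≢v ux with Equivalence.to (rec u x) ux
    ... | _ , i′ , j , u∈′ , x∈ , se with IsSummary.disjoint isS u i′ i u∈′ u∈
    ...   | refl = Equivalence.from (rec v x) ((λ v≡x → x≢v (sym v≡x)) , i′ , j , v∈ , x∈ , se)

  sameNbr sameNbrOutside : Fin n → Fin n → Fin n → C Bool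
  sameNbr u v w = query G u w >>= λ a → query G v w >>= λ b → ret (not (a xor b))
  sameNbrOutside u v w = query G u w >>= λ a → query G v w >>= λ b →
                           ret (not ((a ∧ not (w ≟ᵇ v)) xor (b ∧ not (w ≟ᵇ u))))

  masked : Fin n → Fin n → Fin n → Bool
  masked u v x = adj G u x ∧ not (x ≟ᵇ v)

  masked-≢ : ∀ {u v x} → x ≢ v → masked u v x ≡ adj G u x
  masked-≢ {u} {v} {x} x≢v rewrite ≟ᵇ-≢ x≢v = ∧-identityʳ (adj G u x)

  masked-self : ∀ {u v x} → x ≡ u → masked u v x ≡ false
  masked-self {u} refl rewrite irref G u = refl

  masked-excluded : ∀ {u v x} → x ≡ v → masked u v x ≡ false
  masked-excluded {u} {v} refl rewrite ≟ᵇ-refl v = ∧-zeroʳ (adj G u v)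

  Twins⇒masked≡ : ∀ {u v} → Twins u v → ∀ x → masked u v x ≡ masked v u x
  Twins⇒masked≡ {u} {v} uv x = byCases (x ≟ u) (x ≟ v)
    where
    byCases : Dec (x ≡ u) → Dec (x ≡ v) → masked u v x ≡ masked v u x
    byCases (yes x≡u) _         = trans (masked-self x≡u) (sym (masked-excluded x≡u))
    byCases (no _)    (yes x≡v) = trans (masked-excluded x≡v) (sym (masked-self x≡v))
    byCases (no x≢u)  (no x≢v)  = trans (masked-≢ x≢v) (trans (uv x x≢u x≢v) (sym (masked-≢ x≢u)))

  sameNbrOutside⇒Twins : ∀ {u v} → (∀ x → val (sameNbrOutside u v x) ≡ true) → Twins u v
  sameNbrOutside⇒Twins h x x≢u x≢v =
    trans (sym (masked-≢ x≢v)) (trans (not-xor⇒≡ (h x)) (masked-≢ x≢u))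

  mergeTest-sound : ∀ u v → val (mergeTest G u v) ≡ true → Twins u v
  mergeTest-sound u v e with val (allC (allFin n) (sameNbr u v)) in same
  ... | true  = λ x _ _ → not-xor⇒≡ (allC-true⁻ same (∈-allFin x))
  ... | false = sameNbrOutside⇒Twins (λ x → allC-true⁻ e (∈-allFin x))

  mergeTest-complete : ∀ u v → Twins u v → val (mergeTest G u v) ≡ true
  mergeTest-complete u v uv
    rewrite allC-true⁺ (allFin n) {sameNbrOutside u v} (λ {x} _ → ≡⇒not-xor (Twins⇒masked≡ uv x)) =
    ∨-zeroʳ _

  mergeTest-cost : ∀ u v → cost (mergeTest G u v) ≤ n * 3 + n * 3
  mergeTest-cost u v = +-mono-≤ (queryLoop (λ _ → ≤-refl)) (+0-≤ (queryLoop (λ _ → ≤-refl)))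
    where
    queryLoop : ∀ {p : Fin n → C Bool} → (∀ x → cost (p x) ≤ 2) → cost (allC (allFin n) p) ≤ n * 3
    queryLoop {p} h = subst (λ l → cost (allC (allFin n) p) ≤ l * 3) (length-allFin n)
                            (allC-cost (allFin n) (λ {x} _ → h x))

  candidate : (Fin n → Bool) → Fin n → Fin n → C Bool
  candidate m u v = if m v ∨ (v ≟ᵇ u) then ret false else mergeTest G u v

  candidate-sound : ∀ m u v → val (candidate m u v) ≡ true → m v ≡ false × Twins u v
  candidate-sound m u v e with m v | v ≟ u
  ... | false | no _ = refl , mergeTest-sound u v e

  candidate-complete : ∀ {m u v} → m v ≡ false → v ≢ u → Twins u v → val (candidate m u v) ≡ true
  candidate-complete {m} {u} {v} mv v≢u uv rewrite mv | ≟ᵇ-≢ v≢u = mergeTest-complete u v uv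

  candidate-cost : ∀ m u v → cost (candidate m u v) ≤ n * 3 + n * 3
  candidate-cost m u v with m v ∨ (v ≟ᵇ u)
  ... | true  = z≤n
  ... | false = mergeTest-cost u v

  newClass : (Fin n → Bool) → Fin n → List (Fin n)
  newClass m u = u ∷ val (filterC (candidate m u) (allFin n))

  markClass : (Fin n → Bool) → Fin n → Fin n → Bool
  markClass m u v = m v ∨ any (λ s → s ≟ᵇ v) (newClass m u)

  classes : List (Fin n) → (Fin n → Bool) → List (List (Fin n))
  classes us m = val (phase1 G us m)

  newClass-Twins : ∀ {m u v} → v ∈ newClass m u → Twins u v
  newClass-Twins         (here refl) = Twins-refl
  newClass-Twins {m} {u} (there v∈) =
    proj₂ (candidate-sound m u _ (∈-filterC⁻ (candidate m u) (allFin n) v∈))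

  newClass-unmarked : ∀ {m u v} → m u ≡ false → v ∈ newClass m u → m v ≡ false
  newClass-unmarked         mu (here refl) = mu
  newClass-unmarked {m} {u} mu (there v∈) =
    proj₁ (candidate-sound m u _ (∈-filterC⁻ (candidate m u) (allFin n) v∈))

  newClass-complete : ∀ {m u v} → m v ≡ false → Twins u v → v ∈ newClass m u
  newClass-complete {m} {u} {v} mv uv with v ≟ u
  ... | yes refl = here refl
  ... | no v≢u   =
    there (∈-filterC⁺ (candidate m u) (allFin n) (∈-allFin v) (candidate-complete {m} mv v≢u uv))

  TwinClosed : List (Fin n) → Set
  TwinClosed S = ∀ {a b} → a ∈ S → b ∈ S → Twins a b

  newClass-twinClosed : ∀ {m u} → TwinClosed (newClass m u)
  newClass-twinClosed a∈ b∈ = Twins-trans (Twins-sym (newClass-Twins a∈)) (newClass-Twins b∈)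

  length-newClass : ∀ m u → length (newClass m u) ≤ suc n
  length-newClass m u =
    s≤s (≤-trans (length-filterC (candidate m u) (allFin n)) (≤-reflexive (length-allFin n)))

  markClass-marks : ∀ {m u v} → v ∈ newClass m u → markClass m u v ≡ true
  markClass-marks {m} {u} {v} v∈ =
    trans (cong (m v ∨_) (∈⇒any-≟ᵇ (newClass m u) v∈)) (∨-zeroʳ (m v))

  markClass-unmarked : ∀ {m u v} → m v ≡ false → v ∉ newClass m u → markClass m u v ≡ false
  markClass-unmarked {m} {u} mv v∉ rewrite mv = ∉⇒any-≟ᵇ (newClass m u) v∉

  Apart : List (Fin n) → List (Fin n) → Set
  Apart S S′ = ∀ {a b} → a ∈ S → b ∈ S′ → ¬ Twins a b

  Apart-sym : Symmetric Apart
  Apart-sym apart b∈ a∈ ba = apart a∈ b∈ (Twins-sym ba)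

  classes-All : ∀ {P : List (Fin n) → Set} → (∀ m u → P (newClass m u)) →
                ∀ us m → All P (classes us m)
  classes-All h []       m = []
  classes-All h (u ∷ us) m with m u
  ... | true  = classes-All h us m
  ... | false = h m u ∷ classes-All h us (markClass m u)

  length-classes : ∀ us m → length (classes us m) ≤ length us
  length-classes []       m = z≤n
  length-classes (u ∷ us) m with m u
  ... | true  = m≤n⇒m≤1+n (length-classes us m)
  ... | false = s≤s (length-classes us (markClass m u))

  classes-unmarked : ∀ us m → All (All (λ v → m v ≡ false)) (classes us m)
  classes-unmarked []       m = []
  classes-unmarked (u ∷ us) m with m u in mu
  ... | true  = classes-unmarked us m
  ... | false = All.tabulate (newClass-unmarked mu)
              ∷ All.map (All.map (λ {v} → ∨-conicalˡ (m v) _)) (classes-unmarked us (markClass m u))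

  -- A twin of a member of the new class would have been put into it, hence marked.
  classes-apart : ∀ us m → AllPairs Apart (classes us m)
  classes-apart []       m = []
  classes-apart (u ∷ us) m with m u
  ... | true  = classes-apart us m
  ... | false = All.map apartFromNew (classes-unmarked us (markClass m u))
              ∷ classes-apart us (markClass m u)
    where
    apartFromNew : ∀ {S} → All (λ v → markClass m u v ≡ false) S → Apart (newClass m u) S
    apartFromNew unmarked {b = b} a∈ b∈ ab =
      true≢false (trans (sym (markClass-marks {m} b∈new)) b-unmarked)
      where
      b-unmarked : markClass m u b ≡ false
      b-unmarked = All.lookup unmarked b∈
      b∈new : b ∈ newClass m u
      b∈new = newClass-complete {m} (∨-conicalˡ (m b) _ b-unmarked)
                                    (Twins-trans (newClass-Twins a∈) ab)

  classes-cover : ∀ us m → (∀ w → m w ≡ false → w ∈ us) →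
                  ∀ {v} → m v ≡ false → Any (v ∈_) (classes us m)
  classes-cover []       m h mv with h _ mv
  ... | ()
  classes-cover (u ∷ us) m h {v} mv with m u in mu
  ... | true  = classes-cover us m (∈-drop h (λ mu′ → true≢false (trans (sym mu) mu′))) mv
  ... | false with Any.any? (v ≟_) (newClass m u)
  ...   | yes v∈ = here v∈
  ...   | no v∉  = there (classes-cover us (markClass m u)
                     (∈-drop (λ w e → h w (∨-conicalˡ (m w) _ e))
                             (λ e → true≢false (trans (sym (markClass-marks {m} (here refl))) e)))
                     (markClass-unmarked {m} mv v∉))

  edgeC-sound : ∀ S S′ → val (edgeC G S S′) ≡ true →
                ∃ λ a → ∃ λ b → a ∈ S × b ∈ S′ × adj G a b ≡ true
  edgeC-sound S S′ e with anyC-true⁻ S e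
  ... | a , a∈ , e′ with anyC-true⁻ S′ e′
  ...   | b , b∈ , ab = a , b , a∈ , b∈ , ab

  edgeC-complete : ∀ S S′ {a b} → a ∈ S → b ∈ S′ → adj G a b ≡ true → val (edgeC G S S′) ≡ true
  edgeC-complete S S′ a∈ b∈ ab = anyC-true⁺ S a∈ (anyC-true⁺ S′ b∈ ab)

  edgeC-sym : ∀ S S′ → val (edgeC G S S′) ≡ val (edgeC G S′ S)
  edgeC-sym S S′ = ⇔true⇒≡ (swap S S′) (swap S′ S)
    where
    swap : ∀ S S′ → val (edgeC G S S′) ≡ true → val (edgeC G S′ S) ≡ true
    swap S S′ e with edgeC-sound S S′ e
    ... | a , b , a∈ , b∈ , ab = edgeC-complete S′ S b∈ a∈ (adj-swap ab)

  module _ (ord : List (Fin n)) where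

    twinClasses : List (List (Fin n))
    twinClasses = classes ord (λ _ → false)

    twinClass : Fin (length twinClasses) → List (Fin n)
    twinClass = lookup twinClasses

    twinClass-nonempty : ∀ i → ∃ λ v → v ∈ twinClass i
    twinClass-nonempty i =
      All.lookup (classes-All {P = λ S → ∃ λ v → v ∈ S} (λ m u → u , here refl) ord _) (∈-lookup i)

    twinClass-twinClosed : ∀ {i a b} → a ∈ twinClass i → b ∈ twinClass i → Twins a b
    twinClass-twinClosed {i} =
      All.lookup (classes-All {P = TwinClosed} (λ m u → newClass-twinClosed) ord _) (∈-lookup i)

    Twins⇒same-twinClass : ∀ {i j a b} → a ∈ twinClass i → b ∈ twinClass j → Twins a b → i ≡ j
    Twins⇒same-twinClass {i} {j} a∈ b∈ ab with i ≟ j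
    ... | yes i≡j = i≡j
    ... | no i≢j  = ⊥-elim (AllPairs-lookup Apart-sym (classes-apart ord _) i≢j a∈ b∈ ab)

    module _ (ord↭ : ord ↭ allFin n) where

      twinClass-cover : ∀ v → ∃ λ i → v ∈ twinClass i
      twinClass-cover v = Any.index v∈ , lookup-index v∈
        where
        v∈ : Any (v ∈_) twinClasses
        v∈ = classes-cover ord _ (λ w _ → ∈-resp-↭ (↭-sym ord↭) (∈-allFin w)) refl

      algOutput-isSummary : IsSummary (algOutput G ord)
      algOutput-isSummary = record
        { nonempty  = twinClass-nonempty
        ; covers    = twinClass-cover
        ; disjoint  = λ u i j u∈i u∈j → Twins⇒same-twinClass u∈i u∈j Twins-refl
        ; sedge-sym = λ i j → edgeC-sym (twinClass i) (twinClass j)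
        }

      algOutput-lossless : Lossless G (algOutput G ord)
      algOutput-lossless = algOutput-isSummary , λ u w → mk⇔ (edge⇒rec u w) (rec⇒edge u w)
        where
        edge⇒rec : ∀ u w → adj G u w ≡ true → RecEdge (algOutput G ord) u w
        edge⇒rec u w uw with twinClass-cover u | twinClass-cover w
        ... | i , u∈ | j , w∈ =
          adj⇒≢ uw , i , j , u∈ , w∈ , edgeC-complete (twinClass i) (twinClass j) u∈ w∈ uw

        rec⇒edge : ∀ u w → RecEdge (algOutput G ord) u w → adj G u w ≡ true
        rec⇒edge u w (u≢w , i , j , u∈ , w∈ , se) with edgeC-sound (twinClass i) (twinClass j) se
        ... | a , b , a∈ , b∈ , ab =
          adj-resp-Twins (twinClass-twinClosed a∈ u∈) (twinClass-twinClosed b∈ w∈) ab u≢w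

      algOutput-minimal : ∀ (S : Summary n) → Lossless G S → k (algOutput G ord) ≤ k S
      algOutput-minimal S lossless = injective⇒≤ {f = block} block-injective
        where
        rep : Fin (length twinClasses) → Fin n
        rep i = proj₁ (twinClass-nonempty i)

        block : Fin (length twinClasses) → Fin (k S)
        block i = proj₁ (IsSummary.covers (proj₁ lossless) (rep i))

        rep∈block : ∀ i → rep i ∈ part S (block i)
        rep∈block i = proj₂ (IsSummary.covers (proj₁ lossless) (rep i))

        block-injective : ∀ {i j} → block i ≡ block j → i ≡ j
        block-injective {i} {j} bi≡bj =
          Twins⇒same-twinClass (proj₂ (twinClass-nonempty i)) (proj₂ (twinClass-nonempty j))
            (Lossless⇒Twins lossless (rep∈block i)
                                     (subst (λ b → rep j ∈ part S b) (sym bi≡bj) (rep∈block j)))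

  phase1-cost : ∀ us m → cost (phase1 G us m) ≤ length us * suc (n * suc (n * 3 + n * 3))
  phase1-cost []       m = z≤n
  phase1-cost (u ∷ us) m with m u
  ... | true  = s≤s (≤-trans (phase1-cost us m) (m≤n+m _ _))
  ... | false = s≤s (+-mono-≤ scan (+0-≤ (phase1-cost us (markClass m u))))
    where
    scan : cost (filterC (candidate m u) (allFin n)) ≤ n * suc (n * 3 + n * 3)
    scan = subst (λ l → cost (filterC (candidate m u) (allFin n)) ≤ l * suc (n * 3 + n * 3))
                 (length-allFin n) (filterC-cost (allFin n) (candidate-cost m u))

  edgeC-cost : ∀ S S′ → length S ≤ suc n → length S′ ≤ suc n →
               cost (edgeC G S S′) ≤ suc n * suc (suc n * 2)
  edgeC-cost S S′ |S| |S′| =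
    ≤-trans (anyC-cost S (λ _ → anyC-cost S′ (λ _ → ≤-refl)))
            (*-mono-≤ |S| (s≤s (*-monoˡ-≤ 2 |S′|)))

  superedges-cost : ∀ L → length L ≤ n → All (λ S → length S ≤ suc n) L →
    cost (forC L (λ S → forC L (λ S′ → edgeC G S S′ >>= λ _ → ret true)))
      ≤ n * suc (n * suc (suc n * suc (suc n * 2)))
  superedges-cost L |L| sizes = ≤-trans (allC-cost L row) (*-monoˡ-≤ _ |L|)
    where
    row : ∀ {S} → S ∈ L → cost (forC L (λ S′ → edgeC G S S′ >>= λ _ → ret true))
                           ≤ n * suc (suc n * suc (suc n * 2))
    row {S} S∈ =
      ≤-trans (allC-cost L (λ {S′} S′∈ →
                 +0-≤ (edgeC-cost S S′ (All.lookup sizes S∈) (All.lookup sizes S′∈))))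
              (*-monoˡ-≤ _ |L|)

  algCost-bound : ∀ ord → ord ↭ allFin n → algCost G ord ≤ 13 * suc n ^ 4
  algCost-bound ord ord↭ =
    ≤-trans (+-mono-≤ classesCost (+-monoˡ-≤ 0 superedgesCost)) (phaseBounds≤ n)
    where
    |ord| : length ord ≡ n
    |ord| = trans (↭-length ord↭) (length-allFin n)

    classesCost : cost (phase1 G ord (λ _ → false)) ≤ n * suc (n * suc (n * 3 + n * 3))
    classesCost = subst (λ l → cost (phase1 G ord (λ _ → false)) ≤ l * suc (n * suc (n * 3 + n * 3)))
                        |ord| (phase1-cost ord _)

    superedgesCost : cost (forC (twinClasses ord)
                               (λ S → forC (twinClasses ord) (λ S′ → edgeC G S S′ >>= λ _ → ret true)))
                     ≤ n * suc (n * suc (suc n * suc (suc n * 2)))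
    superedgesCost = superedges-cost (twinClasses ord)
                       (≤-trans (length-classes ord _) (≤-reflexive |ord|))
                       (classes-All length-newClass ord _)

theorem3p3 :
    (∃ λ c → ∃ λ d → ∀ (n : ℕ) (G : Graph n) (ord : List (Fin n)) → ord ↭ allFin n →
      algCost G ord ≤ c * (suc n) ^ d)
    × (∀ (n : ℕ) (G : Graph n) (ord : List (Fin n)) → ord ↭ allFin n →
      Lossless G (algOutput G ord)
      × (∀ (S : Summary n) → Lossless G S → k (algOutput G ord) ≤ k S))
theorem3p3 =
    (13 , 4 , λ n G → algCost-bound G)
  , λ n G ord ord↭ → algOutput-lossless G ord ord↭ , algOutput-minimal G ord ord↭
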